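{- Let $G$ be a finite simple graph that is the union of two elementary cycles sharing exactly one common vertex (two kissing cycles). Then $G$ is not separable.
   Context: A graph $G=(V,E)$ is separable if there exist non-negative real weights $w(e)$, $e\in E$, and a threshold $\alpha\in\mathbb{R}$ such that for every $E'\subseteq E$: $\sum_{e\in E'}w(e)\ge\alpha$ if and only if the spanning subgraph $(V,E')$ is connected. -}

module Defs where

open import Level using (Level; _⊔_) renaming (suc to lsuc)
open import Data.Nat using (ℕ; zero; suc; _≤_)
open import Data.Fin using (Fin; toℕ) renaming (zero to fzero; suc to fsuc)
open import Data.Fin.Subset using (Subset; _∈_)
open import Data.Vec using ([]; _∷_)
open import Data.Bool using (true; false)
open import Data.Product using (Σ; ∃; _×_; _,_)
open import Data.Sum using (_⊎_)
open import Relation.Nullary using (¬_)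
open import Relation.Binary.PropositionalEquality using (_≡_)
open import Relation.Binary.Structures using (IsTotalOrder)
open import Relation.Binary.Construct.Closure.ReflexiveTransitive using (Star)
open import Function.Definitions using (Injective)
open import Algebra.Bundles using (CommutativeRing)

-- Ordered fields (the weights/threshold live in one; ℝ is an instance)

record OrderedField (c ℓ₁ ℓ₂ : Level) : Set (lsuc (c ⊔ ℓ₁ ⊔ ℓ₂)) where
  field
    commRing : CommutativeRing c ℓ₁
  open CommutativeRing commRing public
  field
    _≤F_        : Carrier → Carrier → Set ℓ₂
    isTotalOrder : IsTotalOrder _≈_ _≤F_
    0≢1         : ¬ (0# ≈ 1#)
    inverse     : ∀ x → ¬ (x ≈ 0#) → ∃ λ y → x * y ≈ 1#
    +-mono      : ∀ {x y} z → x ≤F y → (x + z) ≤F (y + z)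
    *-nonneg    : ∀ {x y} → 0# ≤F x → 0# ≤F y → 0# ≤F (x * y)

record Graph : Set where
  field
    n m   : ℕ
    ends  : Fin m → Fin n × Fin n

  Joins : Fin m → Fin n → Fin n → Set
  Joins e x y = (ends e ≡ (x , y)) ⊎ (ends e ≡ (y , x))

  field
    loopless : ∀ e x → ¬ Joins e x x
    noMulti  : ∀ e f x y → Joins e x y → Joins f x y → e ≡ f

open Graph public

module _ (G : Graph) where

  Step : Subset (m G) → Fin (n G) → Fin (n G) → Set
  Step E' x y = ∃ λ e → e ∈ E' × Joins G e x y

  Connected : Subset (m G) → Set
  Connected E' = ∀ x y → Star (Step E') x y

CycSucc : (k : ℕ) → Fin k → Fin k → Set
CycSucc k i j = (suc (toℕ i) ≡ toℕ j) ⊎ ((suc (toℕ i) ≡ k) × (toℕ j ≡ 0))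

record Cycle (G : Graph) : Set where
  field
    len     : ℕ
    len≥3   : 3 ≤ len
    vert    : Fin len → Fin (n G)
    distinct : Injective _≡_ _≡_ vert
    adjacent : ∀ i j → CycSucc len i j → ∃ λ e → Joins G e (vert i) (vert j)

  OnCycle : Fin (n G) → Set
  OnCycle v = ∃ λ i → vert i ≡ v

  EdgeOf : Fin (m G) → Set
  EdgeOf e = ∃ λ i → ∃ λ j → CycSucc len i j × Joins G e (vert i) (vert j)

open Cycle public

KissingCycles : (G : Graph) → Cycle G → Cycle G → Set
KissingCycles G C₁ C₂ =
    (∀ v → OnCycle C₁ v ⊎ OnCycle C₂ v)
  × (∀ e → EdgeOf C₁ e ⊎ EdgeOf C₂ e)
  × (∃ λ v → OnCycle C₁ v × OnCycle C₂ v
             × (∀ u → OnCycle C₁ u → OnCycle C₂ u → u ≡ v))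

module _ {c ℓ₁ ℓ₂} (F : OrderedField c ℓ₁ ℓ₂) where
  open OrderedField F

  sumOver : ∀ {k} → (Fin k → Carrier) → Subset k → Carrier
  sumOver w [] = 0#
  sumOver w (true  ∷ s) = w fzero + sumOver (λ i → w (fsuc i)) s
  sumOver w (false ∷ s) = sumOver (λ i → w (fsuc i)) s

  Separable : Graph → Set (c ⊔ ℓ₂)
  Separable G =
    Σ (Fin (m G) → Carrier) λ w →
      (∀ e → 0# ≤F w e) ×
      Σ Carrier λ α → ∀ (E' : Subset (m G)) →
        (α ≤F sumOver w E' → Connected G E') × (Connected G E' → α ≤F sumOver w E')

module Submission where

-- Separability forces an exchange inequality: if E ∖ {x, y} is connected but
-- E ∖ {x, z} is not, then w z > w y, because the two edge sets carry the same
-- weight apart from w z versus w y. In two kissing cycles C₁, C₂ pick a vertex u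
-- of C₁ not on C₂, and let a′, a be the edges of C₁ entering and leaving u.
-- Removing a′ and any edge b of C₂ leaves a spanning connected subgraph (each
-- cycle loses one edge and they still meet), whereas removing a′ and a isolates
-- u; so a is heavier than every edge of C₂. Symmetrically some edge of C₂ is
-- heavier than every edge of C₁, so each of these two edges would be strictly
-- heavier than the other.

open import Defs
open import Level using (Level)
open import Function using (_∘_; id)
open import Data.Empty using (⊥-elim)
open import Data.Nat as ℕ
  using (ℕ; suc; _≤_; _<_; _≤′_; ≤′-refl; ≤′-step; s≤s; z≤n; NonZero; >-nonZero; >-nonZero⁻¹)
open import Data.Nat.Properties
  using ( ≤⇒≤′; ≤′⇒≤; ≤-trans; ≤-reflexive; n<1+n; m<n⇒m<1+n; ≤∧≢⇒<; <-irrefl; <-asym; <⇒≤; <⇒≢; >⇒≢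
        ; <-≤-trans; ≰⇒>; _≤?_; suc-injective; 1+n≢0)
open import Data.Nat.DivMod using (_%_; _mod_; n%n≡0; m<n⇒m%n≡m)
open import Data.Fin as Fin using (Fin; toℕ; fromℕ; inject₁) renaming (zero to fzero; suc to fsuc)
open import Data.Fin.Properties using (toℕ-injective; toℕ<n; toℕ-fromℕ<; toℕ-fromℕ; toℕ-inject₁; 0≢1+n)
open import Data.Fin.Subset using (Subset; _∈_; _∉_; _-_; ⊤; inside; outside)
open import Data.Fin.Subset.Properties using (∈⊤; x∈p∧x≢y⇒x∈p-y; p─x─y≡p─y─x; p─⊥≡p; p─q⊆p)
open import Data.Vec using (_∷_; here; there)
open import Data.Product using (∃; _×_; _,_; proj₁; proj₂; swap)
open import Data.Product.Properties using (×-≡,≡←≡)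
open import Data.Sum as Sum using (_⊎_; inj₁; inj₂)
open import Function.Definitions using (Injective)
open import Relation.Nullary using (¬_; yes; no)
open import Relation.Binary.Core using (Rel)
open import Relation.Binary.Definitions using (Symmetric)
open import Relation.Binary.Structures using (IsTotalOrder)
open import Relation.Binary.PropositionalEquality using (_≡_; _≢_; refl; sym; trans; cong; subst; subst₂)
open import Relation.Binary.Construct.Closure.ReflexiveTransitive using (Star; ε; _◅_; _◅◅_; reverse; gmap)

module _ {k : ℕ} where

  CycSucc-functional : ∀ {i j j′} → CycSucc k i j → CycSucc k i j′ → j ≡ j′
  CycSucc-functional (inj₁ p) (inj₁ q) = toℕ-injective (trans (sym p) q)
  CycSucc-functional {j = j} (inj₁ p) (inj₂ (q , _)) = ⊥-elim (<-irrefl (trans (sym p) q) (toℕ<n j))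
  CycSucc-functional {j′ = j′} (inj₂ (q , _)) (inj₁ p) = ⊥-elim (<-irrefl (trans (sym p) q) (toℕ<n j′))
  CycSucc-functional (inj₂ (_ , p)) (inj₂ (_ , q)) = toℕ-injective (trans p (sym q))

  CycSucc-injective : ∀ {i i′ j} → CycSucc k i j → CycSucc k i′ j → i ≡ i′
  CycSucc-injective (inj₁ p) (inj₁ q) = toℕ-injective (suc-injective (trans p (sym q)))
  CycSucc-injective (inj₁ p) (inj₂ (_ , q)) = ⊥-elim (1+n≢0 (trans p q))
  CycSucc-injective (inj₂ (_ , q)) (inj₁ p) = ⊥-elim (1+n≢0 (trans p q))
  CycSucc-injective (inj₂ (p , _)) (inj₂ (q , _)) = toℕ-injective (suc-injective (trans p (sym q)))

  CycSucc-irrefl : ∀ {i} → 2 ≤ k → ¬ CycSucc k i i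
  CycSucc-irrefl _ (inj₁ p) = <-irrefl (sym p) (n<1+n _)
  CycSucc-irrefl 2≤k (inj₂ (p , q)) = <-irrefl (trans (cong suc (sym q)) p) 2≤k

  CycSucc-asym : ∀ {i j} → 3 ≤ k → CycSucc k i j → ¬ CycSucc k j i
  CycSucc-asym _ (inj₁ p) (inj₁ q) = <-asym (≤-reflexive p) (≤-reflexive q)
  CycSucc-asym 3≤k (inj₁ p) (inj₂ (q , r)) =
    <-irrefl (trans (cong (suc ∘ suc) (sym r)) (trans (cong suc p) q)) 3≤k
  CycSucc-asym 3≤k (inj₂ (p , r)) (inj₁ q) =
    <-irrefl (trans (cong (suc ∘ suc) (sym r)) (trans (cong suc q) p)) 3≤k
  CycSucc-asym 3≤k (inj₂ (p , _)) (inj₂ (_ , r)) =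
    <-irrefl (trans (cong suc (sym r)) p) (≤-trans (s≤s (s≤s z≤n)) 3≤k)

prev : ∀ {k} → Fin k → Fin k
prev {suc k} fzero = fromℕ k
prev (fsuc i) = inject₁ i

CycSucc-prev : ∀ {k} (i : Fin k) → CycSucc k (prev i) i
CycSucc-prev {suc k} fzero = inj₂ (cong suc (toℕ-fromℕ k) , refl)
CycSucc-prev (fsuc i) = inj₁ (cong suc (toℕ-inject₁ i))

module _ {k : ℕ} .{{_ : NonZero k}} where

  next : Fin k → Fin k
  next i = suc (toℕ i) mod k

  toℕ-mod : ∀ {i} → i < k → toℕ (i mod k) ≡ i
  toℕ-mod i<k = trans (toℕ-fromℕ< _) (m<n⇒m%n≡m i<k)

  mod-toℕ : (i : Fin k) → toℕ i mod k ≡ i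
  mod-toℕ i = toℕ-injective (toℕ-mod (toℕ<n i))

  k-mod≡0-mod : k mod k ≡ 0 mod k
  k-mod≡0-mod = toℕ-injective (trans (toℕ-fromℕ< _) (trans (n%n≡0 k) (sym (toℕ-mod (>-nonZero⁻¹ k)))))

  next-mod : ∀ {i} → i < k → next (i mod k) ≡ suc i mod k
  next-mod i<k = cong (λ j → suc j mod k) (toℕ-mod i<k)

  CycSucc-next : ∀ i → CycSucc k i (next i)
  CycSucc-next i with suc (toℕ i) ℕ.≟ k
  ... | yes 1+i≡k = inj₂ (1+i≡k , trans (toℕ-fromℕ< _) (trans (cong (_% k) 1+i≡k) (n%n≡0 k)))
  ... | no 1+i≢k = inj₁ (sym (toℕ-mod (≤∧≢⇒< (toℕ<n i) 1+i≢k)))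

  CycSucc⇒next≡ : ∀ {i j} → CycSucc k i j → next i ≡ j
  CycSucc⇒next≡ {i} = CycSucc-functional (CycSucc-next i)

Star-chain : ∀ {a ℓ} {A : Set a} {R : Rel A ℓ} (f : ℕ → A) {lo hi : ℕ} → lo ≤′ hi →
             (∀ i → lo ≤ i → i < hi → R (f i) (f (suc i))) → Star R (f lo) (f hi)
Star-chain f ≤′-refl _ = ε
Star-chain f (≤′-step lo≤′hi) step =
  Star-chain f lo≤′hi (λ i lo≤i i<hi → step i lo≤i (m<n⇒m<1+n i<hi))
  ◅◅ step _ (≤′⇒≤ lo≤′hi) (n<1+n _) ◅ ε

module _ {k : ℕ} .{{_ : NonZero k}} {ℓ} {R : Rel (Fin k) ℓ} (R-sym : Symmetric R)
         (r : Fin k) (R-next : ∀ i → i ≢ r → R i (next i)) where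

  private
    walk : ∀ {lo hi} → lo ≤ hi → hi ≤ k → (∀ i → lo ≤ i → i < hi → i ≢ toℕ r) →
           Star R (lo mod k) (hi mod k)
    walk lo≤hi hi≤k avoids = Star-chain (_mod k) (≤⇒≤′ lo≤hi) λ i lo≤i i<hi →
      let i<k = <-≤-trans i<hi hi≤k in
      subst (R (i mod k)) (next-mod i<k)
        (R-next (i mod k) λ eq → avoids i lo≤i i<hi (trans (sym (toℕ-mod i<k)) (cong toℕ eq)))

    -- Positions up to r are reached walking forward from 0, the others walking
    -- forward to k, which is position 0 again.
    from-zero : ∀ j → Star R (0 mod k) j
    from-zero j with toℕ j ≤? toℕ r
    ... | yes j≤r = subst (Star R _) (mod-toℕ j)
          (walk z≤n (<⇒≤ (toℕ<n j)) λ i _ i<j → <⇒≢ (<-≤-trans i<j j≤r))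
    ... | no j≰r = subst₂ (Star R) k-mod≡0-mod (mod-toℕ j) (reverse R-sym
          (walk (<⇒≤ (toℕ<n j)) (≤-reflexive refl) λ i j≤i _ → >⇒≢ (<-≤-trans (≰⇒> j≰r) j≤i)))

  Star-cycle-minus-edge : ∀ i j → Star R i j
  Star-cycle-minus-edge i j = reverse R-sym (from-zero i) ◅◅ from-zero j

injective-avoids : ∀ {k n} {f : Fin k → Fin n} → 2 ≤ k → Injective _≡_ _≡_ f → ∀ v → ∃ λ i → f i ≢ v
injective-avoids {f = f} (s≤s (s≤s _)) f-inj v with f fzero Fin.≟ v
... | no f0≢v = fzero , f0≢v
... | yes f0≡v = fsuc fzero , λ f1≡v → 0≢1+n (f-inj (trans f0≡v (sym f1≡v)))

x∉p-x : ∀ {k} (p : Subset k) x → x ∉ p - x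
x∉p-x (_ ∷ p) fzero ()
x∉p-x (_ ∷ p) (fsuc x) (there x∈p-x) = x∉p-x p x x∈p-x

x∈p-y⇒x≢y : ∀ {k} {p : Subset k} {x y} → x ∈ p - y → x ≢ y
x∈p-y⇒x≢y x∈p-x refl = x∉p-x _ _ x∈p-x

module _ (G : Graph) where

  Joins-sym : ∀ {e x y} → Joins G e x y → Joins G e y x
  Joins-sym (inj₁ p) = inj₂ p
  Joins-sym (inj₂ p) = inj₁ p

  Joins-ends : ∀ {e x y x′ y′} → Joins G e x y → Joins G e x′ y′ →
               (x ≡ x′ × y ≡ y′) ⊎ (x ≡ y′ × y ≡ x′)
  Joins-ends (inj₁ p) (inj₁ q) = inj₁ (×-≡,≡←≡ (trans (sym p) q))
  Joins-ends (inj₁ p) (inj₂ q) = inj₂ (×-≡,≡←≡ (trans (sym p) q))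
  Joins-ends (inj₂ p) (inj₁ q) = inj₂ (swap (×-≡,≡←≡ (trans (sym p) q)))
  Joins-ends (inj₂ p) (inj₂ q) = inj₁ (swap (×-≡,≡←≡ (trans (sym p) q)))

  Step-sym : ∀ {E′} → Symmetric (Step G E′)
  Step-sym (e , e∈E′ , joins) = e , e∈E′ , Joins-sym joins

  isolated⇒¬Connected : ∀ {E′ x y} → (∀ e z → e ∈ E′ → ¬ Joins G e x z) → x ≢ y → ¬ Connected G E′
  isolated⇒¬Connected {x = x} {y} isolated x≢y connected with connected x y
  ... | ε = x≢y refl
  ... | (e , e∈E′ , joins) ◅ _ = isolated e _ e∈E′ joins

module _ {G : Graph} (C : Cycle G) where

  private
    instance
      len-nonZero : NonZero (len C)
      len-nonZero = >-nonZero (≤-trans (s≤s z≤n) (len≥3 C))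

    2≤len : 2 ≤ len C
    2≤len = ≤-trans (s≤s (s≤s z≤n)) (len≥3 C)

  edgeAt : Fin (len C) → Fin (m G)
  edgeAt i = proj₁ (adjacent C i (next i) (CycSucc-next i))

  edgeAt-joins : ∀ i → Joins G (edgeAt i) (vert C i) (vert C (next i))
  edgeAt-joins i = proj₂ (adjacent C i (next i) (CycSucc-next i))

  edgeAt-EdgeOf : ∀ i → EdgeOf C (edgeAt i)
  edgeAt-EdgeOf i = i , next i , CycSucc-next i , edgeAt-joins i

  EdgeOf⇒edgeAt : ∀ {e} → EdgeOf C e → ∃ λ i → e ≡ edgeAt i
  EdgeOf⇒edgeAt {e} (i , j , i→j , joins) =
    i , noMulti G e (edgeAt i) (vert C i) (vert C (next i))
          (subst (Joins G e (vert C i) ∘ vert C) (sym (CycSucc⇒next≡ i→j)) joins) (edgeAt-joins i)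

  EdgeOf-endpoint : ∀ {e x y} → EdgeOf C e → Joins G e x y → OnCycle C x
  EdgeOf-endpoint (i , j , _ , joins′) joins with Joins-ends G joins joins′
  ... | inj₁ (x≡vi , _) = i , sym x≡vi
  ... | inj₂ (x≡vj , _) = j , sym x≡vj

  edgeAt-injective : ∀ {i j} → edgeAt i ≡ edgeAt j → i ≡ j
  edgeAt-injective {i} {j} eq
    with Joins-ends G (subst (λ e → Joins G e _ _) eq (edgeAt-joins i)) (edgeAt-joins j)
  ... | inj₁ (vi≡vj , _) = distinct C vi≡vj
  ... | inj₂ (vi≡vnj , vni≡vj) = ⊥-elim (CycSucc-asym (len≥3 C)
          (subst (CycSucc (len C) i) (distinct C vni≡vj) (CycSucc-next i))
          (subst (CycSucc (len C) j) (sym (distinct C vi≡vnj)) (CycSucc-next j)))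

  edgeAt-prev≢edgeAt : ∀ i → edgeAt (prev i) ≢ edgeAt i
  edgeAt-prev≢edgeAt i eq =
    CycSucc-irrefl 2≤len (subst (λ p → CycSucc (len C) p i) (edgeAt-injective eq) (CycSucc-prev i))

  EdgeOf-incident : ∀ {e i y} → EdgeOf C e → Joins G e (vert C i) y → e ≡ edgeAt (prev i) ⊎ e ≡ edgeAt i
  EdgeOf-incident {e} {i} e∈C joins with EdgeOf⇒edgeAt e∈C
  ... | p , refl with Joins-ends G joins (edgeAt-joins p)
  ...   | inj₁ (vi≡vp , _) = inj₂ (cong edgeAt (sym (distinct C vi≡vp)))
  ...   | inj₂ (vi≡vnp , _) = inj₁ (cong edgeAt (CycSucc-injective
            (subst (CycSucc (len C) p) (sym (distinct C vi≡vnp)) (CycSucc-next p)) (CycSucc-prev i)))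

  Cycle-connected-except : ∀ {E′} r → (∀ i → i ≢ r → edgeAt i ∈ E′) →
                           ∀ i j → Star (Step G E′) (vert C i) (vert C j)
  Cycle-connected-except {E′} r has-edge i j =
    gmap (vert C) id
      (Star-cycle-minus-edge {R = λ i j → Step G E′ (vert C i) (vert C j)} (Step-sym G) r
        (λ i i≢r → edgeAt i , has-edge i i≢r , edgeAt-joins i) i j)

  Cycle-avoids : ∀ v → ∃ λ i → vert C i ≢ v
  Cycle-avoids = injective-avoids 2≤len (distinct C)

module _ {G : Graph} (C₁ C₂ : Cycle G) where

  KissingCycles-sym : KissingCycles G C₁ C₂ → KissingCycles G C₂ C₁
  KissingCycles-sym (covers , edges , v , v∈C₁ , v∈C₂ , shared) =
    Sum.swap ∘ covers , Sum.swap ∘ edges , v , v∈C₂ , v∈C₁ , λ u u∈C₂ u∈C₁ → shared u u∈C₁ u∈C₂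

  EdgeOf-disjoint : KissingCycles G C₁ C₂ → ∀ {e} → EdgeOf C₁ e → ¬ EdgeOf C₂ e
  EdgeOf-disjoint (_ , _ , v , _ , _ , shared) {e} e∈C₁ e∈C₂ with proj₂ (proj₂ e∈C₁)
  ... | _ , joins = loopless G e v (subst₂ (Joins G e) (on-both joins) (on-both (Joins-sym G joins)) joins)
    where
      on-both : ∀ {x y} → Joins G e x y → x ≡ v
      on-both joins = shared _ (EdgeOf-endpoint C₁ e∈C₁ joins) (EdgeOf-endpoint C₂ e∈C₂ joins)

  edgeAt-disjoint : KissingCycles G C₁ C₂ → ∀ i j → edgeAt C₁ i ≢ edgeAt C₂ j
  edgeAt-disjoint kiss i j eq =
    EdgeOf-disjoint kiss (edgeAt-EdgeOf C₁ i) (subst (EdgeOf C₂) (sym eq) (edgeAt-EdgeOf C₂ j))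

  lone-vertex : KissingCycles G C₁ C₂ → ∃ λ i → ¬ OnCycle C₂ (vert C₁ i)
  lone-vertex (_ , _ , v , _ , _ , shared) with Cycle-avoids C₁ v
  ... | i , vi≢v = i , λ vi∈C₂ → vi≢v (shared _ (i , refl) vi∈C₂)

  KissingCycles-connected : KissingCycles G C₁ C₂ → ∀ {E′} r₁ r₂ →
    (∀ i → i ≢ r₁ → edgeAt C₁ i ∈ E′) → (∀ i → i ≢ r₂ → edgeAt C₂ i ∈ E′) → Connected G E′
  KissingCycles-connected (covers , _ , v , (i₁ , refl) , (i₂ , vi₂≡v) , _) {E′} r₁ r₂ has₁ has₂ x y =
    to-v x ◅◅ reverse (Step-sym G) (to-v y)
    where
      to-v : ∀ x → Star (Step G E′) x (vert C₁ i₁)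
      to-v x with covers x
      ... | inj₁ (i , refl) = Cycle-connected-except C₁ r₁ has₁ i i₁
      ... | inj₂ (i , refl) = subst (Star (Step G E′) _) vi₂≡v (Cycle-connected-except C₂ r₂ has₂ i i₂)

  KissingCycles-⊤-minus-connected : KissingCycles G C₁ C₂ → ∀ r₁ r₂ →
                                    Connected G (⊤ - edgeAt C₁ r₁ - edgeAt C₂ r₂)
  KissingCycles-⊤-minus-connected kiss r₁ r₂ = KissingCycles-connected kiss r₁ r₂
    (λ i i≢r₁ → x∈p∧x≢y⇒x∈p-y (x∈p∧x≢y⇒x∈p-y ∈⊤ (i≢r₁ ∘ edgeAt-injective C₁)) (edgeAt-disjoint kiss i r₂))
    (λ i i≢r₂ → x∈p∧x≢y⇒x∈p-y (x∈p∧x≢y⇒x∈p-y ∈⊤ (edgeAt-disjoint kiss r₁ i ∘ sym)) (i≢r₂ ∘ edgeAt-injective C₂))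

  lone-vertex-isolated : KissingCycles G C₁ C₂ → ∀ {i} → ¬ OnCycle C₂ (vert C₁ i) →
                         ¬ Connected G (⊤ - edgeAt C₁ (prev i) - edgeAt C₁ i)
  lone-vertex-isolated (_ , edges , v , _ , v∈C₂ , _) {i} lone =
    isolated⇒¬Connected G isolated λ vi≡v → lone (subst (OnCycle C₂) (sym vi≡v) v∈C₂)
    where
      isolated : ∀ e z → e ∈ ⊤ - edgeAt C₁ (prev i) - edgeAt C₁ i → ¬ Joins G e (vert C₁ i) z
      isolated e z e∈E′ joins with edges e
      ... | inj₂ e∈C₂ = lone (EdgeOf-endpoint C₂ e∈C₂ joins)
      ... | inj₁ e∈C₁ with EdgeOf-incident C₁ e∈C₁ joins
      ...   | inj₁ refl = x∈p-y⇒x≢y (p─q⊆p _ _ e∈E′) refl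
      ...   | inj₂ refl = x∈p-y⇒x≢y e∈E′ refl

module _ {c ℓ₁ ℓ₂} (F : OrderedField c ℓ₁ ℓ₂) where

  open OrderedField F using (Carrier; _≈_; _+_; _≤F_; isTotalOrder; +-mono; +-congˡ; +-commutativeSemigroup)
    renaming (reflexive to ≈-reflexive; trans to ≈-trans)
  open import Algebra.Properties.CommutativeSemigroup +-commutativeSemigroup using (x∙yz≈y∙xz)

  sumOver-remove : ∀ {k} (w : Fin k → Carrier) {p : Subset k} {x} → x ∈ p →
                   sumOver F w p ≈ w x + sumOver F w (p - x)
  sumOver-remove w {inside ∷ p} here = +-congˡ (≈-reflexive (cong (sumOver F (w ∘ fsuc)) (sym (p─⊥≡p p))))
  sumOver-remove w {inside ∷ p} (there x∈p) =
    ≈-trans (+-congˡ (sumOver-remove (w ∘ fsuc) x∈p)) (x∙yz≈y∙xz _ _ _)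
  sumOver-remove w {outside ∷ p} (there x∈p) = sumOver-remove (w ∘ fsuc) x∈p

  Threshold : ∀ {k} → (Fin k → Carrier) → Carrier → (Subset k → Set) → Set ℓ₂
  Threshold w α P = ∀ p → (α ≤F sumOver F w p → P p) × (P p → α ≤F sumOver F w p)

  exchange : ∀ {k} {w : Fin k → Carrier} {α P} → Threshold w α P →
             ∀ {p y z} → y ∈ p → z ∈ p → y ≢ z → P (p - y) → ¬ P (p - z) → ¬ (w z ≤F w y)
  exchange {w = w} {α} threshold {p} {y} {z} y∈p z∈p y≢z P[p-y] ¬P[p-z] wz≤wy =
    ¬P[p-z] (proj₁ (threshold (p - z)) α≤Σ[p-z])
    where
      open import Relation.Binary.Reasoning.Base.Double (IsTotalOrder.isPreorder isTotalOrder)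
      R = sumOver F w (p - y - z)
      α≤Σ[p-z] : α ≤F sumOver F w (p - z)
      α≤Σ[p-z] = begin
        α                              ≲⟨ proj₂ (threshold (p - y)) P[p-y] ⟩
        sumOver F w (p - y)            ≈⟨ sumOver-remove w (x∈p∧x≢y⇒x∈p-y z∈p (y≢z ∘ sym)) ⟩
        w z + R                        ≲⟨ +-mono R wz≤wy ⟩
        w y + R                        ≡⟨ cong (λ q → w y + sumOver F w q) (p─x─y≡p─y─x p y z) ⟩
        w y + sumOver F w (p - z - y)  ≈⟨ sumOver-remove w (x∈p∧x≢y⇒x∈p-y y∈p y≢z) ⟨
        sumOver F w (p - z)            ∎

  lone-edge-heavier : ∀ {G : Graph} (C₁ C₂ : Cycle G) → KissingCycles G C₁ C₂ →
                      ∀ {w α} → Threshold w α (Connected G) →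
                      ∀ {i} → ¬ OnCycle C₂ (vert C₁ i) → ∀ j → ¬ (w (edgeAt C₁ i) ≤F w (edgeAt C₂ j))
  lone-edge-heavier C₁ C₂ kiss threshold {i} lone j =
    exchange threshold
      (x∈p∧x≢y⇒x∈p-y ∈⊤ (edgeAt-disjoint C₁ C₂ kiss (prev i) j ∘ sym))
      (x∈p∧x≢y⇒x∈p-y ∈⊤ (edgeAt-prev≢edgeAt C₁ i ∘ sym))
      (edgeAt-disjoint C₁ C₂ kiss i j ∘ sym)
      (KissingCycles-⊤-minus-connected C₁ C₂ kiss (prev i) j)
      (lone-vertex-isolated C₁ C₂ kiss lone)

corollary3 : ∀ {c ℓ₁ ℓ₂ : Level} (F : OrderedField c ℓ₁ ℓ₂) (G : Graph) (C₁ C₂ : Cycle G) →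
             KissingCycles G C₁ C₂ → ¬ Separable F G
corollary3 F G C₁ C₂ kiss (w , _ , _ , threshold)
  with lone-vertex C₁ C₂ kiss | lone-vertex C₂ C₁ (KissingCycles-sym C₁ C₂ kiss)
... | i₁ , lone₁ | i₂ , lone₂
  with IsTotalOrder.total (OrderedField.isTotalOrder F) (w (edgeAt C₁ i₁)) (w (edgeAt C₂ i₂))
...   | inj₁ a≤b = lone-edge-heavier F C₁ C₂ kiss threshold lone₁ i₂ a≤b
...   | inj₂ b≤a = lone-edge-heavier F C₂ C₁ (KissingCycles-sym C₁ C₂ kiss) threshold lone₂ i₁ b≤a
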